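{- If $n \geq 2$ and $m_i \geq 2$ for all $1 \leq i \leq n$, then there exists a group identifying code in $G = K_{m_1} \square \cdots \square K_{m_n}$.
   Context: $G$ is the Hamming graph with vertex set $\mathbb{Z}_{m_1} \times \cdots \times \mathbb{Z}_{m_n}$, a group under componentwise modular addition, two vertices adjacent iff they differ in exactly one coordinate. For $C \subseteq V(G)$, $J_C(v) = N[v] \cap C$ with $N[v]$ the closed neighborhood. $C$ is an identifying code if the sets $J_C(v)$, $v \in V(G)$, are all nonempty and pairwise distinct; a group identifying code is an identifying code that is a subgroup of $V(G)$. -}

module Defs where

open import Data.Nat using (ℕ; zero; suc; _+_; _∸_; _%_; _≤_)
open import Data.Nat.DivMod using (m%n<n)
open import Data.Fin using (Fin; toℕ; fromℕ<)
open import Data.Bool using (Bool; true)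
open import Data.Product using (Σ; ∃; _×_; _,_)
open import Data.Sum using (_⊎_)
open import Relation.Binary.PropositionalEquality using (_≡_; _≢_)
open import Relation.Nullary using (¬_)

_⊕_ : ∀ {m} → Fin m → Fin m → Fin m
_⊕_ {suc k} a b = fromℕ< (m%n<n (toℕ a + toℕ b) (suc k))

⊖_ : ∀ {m} → Fin m → Fin m
⊖_ {suc k} a = fromℕ< (m%n<n (suc k ∸ toℕ a) (suc k))

-- Vertices of the Hamming graph K_{m_1} □ ... □ K_{m_n}:
-- elements of ℤ_{m_1} × ... × ℤ_{m_n}.
Vertex : ∀ {n} → (Fin n → ℕ) → Set
Vertex {n} m = (i : Fin n) → Fin (m i)

_≈_ : ∀ {n} {m : Fin n → ℕ} → Vertex m → Vertex m → Set
u ≈ v = ∀ i → u i ≡ v i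

_+ᵥ_ : ∀ {n} {m : Fin n → ℕ} → Vertex m → Vertex m → Vertex m
(u +ᵥ v) i = u i ⊕ v i

-ᵥ_ : ∀ {n} {m : Fin n → ℕ} → Vertex m → Vertex m
(-ᵥ u) i = ⊖ (u i)

Adj : ∀ {n} {m : Fin n → ℕ} → Vertex m → Vertex m → Set
Adj {n} u v = Σ (Fin n) λ i → (u i ≢ v i) × (∀ j → j ≢ i → u j ≡ v j)

InClosedNbhd : ∀ {n} {m : Fin n → ℕ} → Vertex m → Vertex m → Set
InClosedNbhd w v = (w ≈ v) ⊎ Adj w v

Subset : ∀ {n} → (Fin n → ℕ) → Set
Subset m = Vertex m → Bool

_∈_ : ∀ {n} {m : Fin n → ℕ} → Vertex m → Subset m → Set
v ∈ C = C v ≡ true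

_∈J[_]_ : ∀ {n} {m : Fin n → ℕ} → Vertex m → Subset m → Vertex m → Set
w ∈J[ C ] v = InClosedNbhd w v × (w ∈ C)

IsIdentifyingCode : ∀ {n} {m : Fin n → ℕ} → Subset m → Set
IsIdentifyingCode {m = m} C =
  (∀ (v : Vertex m) → ∃ λ w → w ∈J[ C ] v) ×
  (∀ (u v : Vertex m) → ¬ (u ≈ v) →
     ¬ (∀ w → ((w ∈J[ C ] u → w ∈J[ C ] v) × (w ∈J[ C ] v → w ∈J[ C ] u))))

IsSubgroup : ∀ {n} {m : Fin n → ℕ} → Subset m → Set
IsSubgroup {m = m} C =
  (∃ λ (v : Vertex m) → v ∈ C) ×
  (∀ (u v : Vertex m) → u ∈ C → v ∈ C → (u +ᵥ v) ∈ C) ×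
  (∀ (u : Vertex m) → u ∈ C → (-ᵥ u) ∈ C) ×
  (∀ (u v : Vertex m) → u ≈ v → u ∈ C → v ∈ C)

IsGroupIdentifyingCode : ∀ {n} {m : Fin n → ℕ} → Subset m → Set
IsGroupIdentifyingCode C = IsIdentifyingCode C × IsSubgroup C

module Submission where

open import Defs
open import Data.Nat using (ℕ; _≤_; s≤s; z≤n)
open import Data.Nat.Properties using (<⇒≤)
open import Data.Fin using (Fin; zero; suc; _≟_; fromℕ<)
open import Data.Product using (∃; _,_; proj₁; proj₂; _×_)
open import Data.Sum using (inj₁; inj₂)
open import Data.Bool using (true)
open import Relation.Binary.PropositionalEquality using (_≡_; refl; sym; trans; _≢_; ≢-sym; module ≡-Reasoning)
open import Relation.Nullary using (yes; no; ¬_)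
open import Data.Empty using (⊥-elim)
open ≡-Reasoning

-- The whole group is a subgroup, and in a twin-free graph the whole vertex set is an
-- identifying code.  The Hamming graph is twin-free once n ≥ 2: if u and v differ only in
-- coordinate i, changing u in some other coordinate j gives a neighbour of u that differs
-- from v in two coordinates.

fin-≢ : ∀ {k} → 2 ≤ k → (x : Fin k) → ∃ λ y → y ≢ x
fin-≢ (s≤s (s≤s z≤n)) zero    = suc zero , λ ()
fin-≢ (s≤s (s≤s z≤n)) (suc x) = zero , λ ()

module _ {n : ℕ} {m : Fin n → ℕ} where

  full : Subset m
  full _ = true

  full-isSubgroup : Vertex m → IsSubgroup full
  full-isSubgroup v = (v , refl) , (λ _ _ _ _ → refl) , (λ _ _ → refl) , (λ _ _ _ _ → refl)

  IsTwinFree : Set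
  IsTwinFree = ∀ (u v : Vertex m) → ¬ (u ≈ v) →
    ¬ (∀ w → (InClosedNbhd w u → InClosedNbhd w v) × (InClosedNbhd w v → InClosedNbhd w u))

  full-isIdentifyingCode : IsTwinFree → IsIdentifyingCode full
  full-isIdentifyingCode twinFree = (λ v → v , inj₁ (λ _ → refl) , refl) , separates
    where
    separates : ∀ u v → ¬ (u ≈ v) →
      ¬ (∀ w → ((w ∈J[ full ] u → w ∈J[ full ] v) × (w ∈J[ full ] v → w ∈J[ full ] u)))
    separates u v u≉v sameJ = twinFree u v u≉v λ w →
      (λ w∈N[u] → proj₁ (proj₁ (sameJ w) (w∈N[u] , refl))) ,
      (λ w∈N[v] → proj₁ (proj₂ (sameJ w) (w∈N[v] , refl)))

  _[_≔_] : Vertex m → (j : Fin n) → Fin (m j) → Vertex m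
  (u [ j ≔ x ]) k with k ≟ j
  ... | yes refl = x
  ... | no _     = u k

  ≔-updates : ∀ u j x → (u [ j ≔ x ]) j ≡ x
  ≔-updates u j x with j ≟ j
  ... | yes refl = refl
  ... | no j≢j   = ⊥-elim (j≢j refl)

  ≔-minimal : ∀ u j x k → k ≢ j → (u [ j ≔ x ]) k ≡ u k
  ≔-minimal u j x k k≢j with k ≟ j
  ... | yes refl = ⊥-elim (k≢j refl)
  ... | no _     = refl

  adj-≔ : ∀ u j x → x ≢ u j → Adj (u [ j ≔ x ]) u
  adj-≔ u j x x≢uj = j , (λ e → x≢uj (trans (sym (≔-updates u j x)) e)) , ≔-minimal u j x

  adj-private-neighbour : 2 ≤ n → (∀ i → 2 ≤ m i) → ∀ u v → Adj u v →
    ∃ λ w → Adj w u × ¬ InClosedNbhd w v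
  adj-private-neighbour 2≤n 2≤m u v (i , ui≢vi , ul≡vl) =
    w , adj-≔ u j x x≢uj , w∉N[v]
    where
    j    = proj₁ (fin-≢ 2≤n i)
    j≢i  = proj₂ (fin-≢ 2≤n i)
    x    = proj₁ (fin-≢ (2≤m j) (u j))
    x≢uj = proj₂ (fin-≢ (2≤m j) (u j))
    w    = u [ j ≔ x ]
    wi≡ui : w i ≡ u i
    wi≡ui = ≔-minimal u j x i (≢-sym j≢i)
    w∉N[v] : ¬ InClosedNbhd w v
    w∉N[v] (inj₁ w≈v) = ui≢vi (trans (sym wi≡ui) (w≈v i))
    w∉N[v] (inj₂ (k , _ , wl≡vl)) with k ≟ i
    ... | no k≢i   = ui≢vi (trans (sym wi≡ui) (wl≡vl i (≢-sym k≢i)))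
    ... | yes refl = x≢uj (begin
      x   ≡⟨ sym (≔-updates u j x) ⟩
      w j ≡⟨ wl≡vl j j≢i ⟩
      v j ≡⟨ sym (ul≡vl j j≢i) ⟩
      u j ∎)

  hamming-isTwinFree : 2 ≤ n → (∀ i → 2 ≤ m i) → IsTwinFree
  hamming-isTwinFree 2≤n 2≤m u v u≉v sameN with proj₁ (sameN u) (inj₁ (λ _ → refl))
  ... | inj₁ u≈v    = u≉v u≈v
  ... | inj₂ u~v with adj-private-neighbour 2≤n 2≤m u v u~v
  ...   | w , w~u , w∉N[v] = w∉N[v] (proj₁ (sameN w) (inj₂ w~u))

corollary3p4 : (n : ℕ) (m : Fin n → ℕ) → 2 ≤ n → (∀ i → 2 ≤ m i) →
    ∃ λ (C : Subset m) → IsGroupIdentifyingCode C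
corollary3p4 n m 2≤n 2≤m =
  full , full-isIdentifyingCode (hamming-isTwinFree 2≤n 2≤m) ,
  full-isSubgroup (λ i → fromℕ< (<⇒≤ (2≤m i)))
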